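{- Let $r\ge 1$ be an integer and suppose that $B,C\subseteq\mathbb{F}_2^r$ are disjoint and non-empty. If $|B|+|C|>2^{r-1}$, then $(B\cup C)\cap(B+C)\ne\varnothing$.
   Context: $\mathbb{F}_2^r$ denotes the elementary abelian $2$-group of rank $r$, and $B+C:=\{b+c\colon b\in B,\ c\in C\}$. -}

module Defs where

open import Data.Bool using (Bool; _xor_)
open import Data.Vec using (Vec; zipWith)
open import Data.Nat using (ℕ)

F₂^ : ℕ → Set
F₂^ r = Vec Bool r

_⊕_ : ∀ {r} → F₂^ r → F₂^ r → F₂^ r
_⊕_ = zipWith _xor_

module Submission where

-- Let S = B ∪ C ⊆ F₂^(k+1) and suppose, for a contradiction, that no sum
-- b ⊕ c (b ∈ B, c ∈ C) lies in S; call B, C *separated*.  Fix b₀ ∈ B and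
-- c₀ ∈ C and translate each x ∈ S by b₀ or by c₀:
--
--     f x = x ⊕ b₀   if x ⊕ c₀ ∈ C,      f x = x ⊕ c₀   otherwise.
--
-- Separation forces f to be injective on S and f(S) to be disjoint from S,
-- so S together with f(S) are 2|S| distinct vectors: 2|S| ≤ 2^(k+1), i.e.
-- |B| + |C| ≤ 2^k, contradicting the hypothesis.  Since membership is
-- decidable, "not separated" yields an explicit collision b ⊕ c ∈ B ∪ C.

open import Defs
open import Data.Nat using (ℕ; zero; suc; _+_; _*_; _^_; _>_; _≤_; z≤n; s≤s)
open import Data.Nat.Properties
  using (+-identityʳ; *-cancelˡ-≤; <⇒≱; module ≤-Reasoning)
open import Data.Bool using (false; true)
open import Data.Bool.Properties using (xor-assoc; xor-comm; xor-identityʳ; xor-same)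
  renaming (_≟_ to _≟ᴮ_)
open import Data.Vec using ([]; _∷_; replicate)
open import Data.Vec.Properties using (zipWith-assoc; zipWith-comm; zipWith-identityʳ; ≡-dec)
open import Data.List using (List; []; _∷_; _++_; map; length)
open import Data.List.Properties using (length-++; length-map; length-removeAt′)
open import Data.List.Relation.Unary.All as All using ()
open import Data.List.Relation.Unary.Any using (here; there; any?; index; _─_)
open import Data.List.Relation.Unary.AllPairs using (_∷_)
open import Data.List.Relation.Unary.Unique.Propositional using (Unique; [])
open import Data.List.Relation.Unary.Unique.Propositional.Properties using (++⁺)
open import Data.List.Relation.Binary.Disjoint.Propositional using (Disjoint)
open import Data.List.Membership.Propositional using (_∈_; _∉_; find; lose)
open import Data.List.Membership.Propositional.Properties
  using (∈-map⁺; ∈-map⁻; ∈-++⁺ˡ; ∈-++⁺ʳ; ∈-++⁻)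
open import Data.Product using (∃-syntax; _×_; _,_)
open import Data.Sum using (_⊎_; inj₁; inj₂; [_,_])
open import Function using (_∘_)
open import Relation.Nullary using (Dec; yes; no; contradiction)
open import Relation.Binary.PropositionalEquality
  using (_≡_; _≢_; refl; sym; trans; cong; cong₂; subst; module ≡-Reasoning)

0ᵛ : ∀ {n} → F₂^ n
0ᵛ = replicate _ false

⊕-assoc : ∀ {n} (x y z : F₂^ n) → (x ⊕ y) ⊕ z ≡ x ⊕ (y ⊕ z)
⊕-assoc = zipWith-assoc xor-assoc

⊕-comm : ∀ {n} (x y : F₂^ n) → x ⊕ y ≡ y ⊕ x
⊕-comm = zipWith-comm xor-comm

⊕-identityʳ : ∀ {n} (x : F₂^ n) → x ⊕ 0ᵛ ≡ x
⊕-identityʳ = zipWith-identityʳ xor-identityʳ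

⊕-self : ∀ {n} (x : F₂^ n) → x ⊕ x ≡ 0ᵛ
⊕-self []      = refl
⊕-self (a ∷ x) = cong₂ _∷_ (xor-same a) (⊕-self x)

⊕-involutive : ∀ {n} (x y : F₂^ n) → (x ⊕ y) ⊕ y ≡ x
⊕-involutive x y = begin
  (x ⊕ y) ⊕ y  ≡⟨ ⊕-assoc x y y ⟩
  x ⊕ (y ⊕ y)  ≡⟨ cong (x ⊕_) (⊕-self y) ⟩
  x ⊕ 0ᵛ       ≡⟨ ⊕-identityʳ x ⟩
  x            ∎
  where open ≡-Reasoning

⊕-transpose : ∀ {n} {x c y : F₂^ n} → x ⊕ c ≡ y → x ≡ y ⊕ c
⊕-transpose {x = x} {c} e = trans (sym (⊕-involutive x c)) (cong (_⊕ c) e)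

⊕-cancelʳ : ∀ {n} {x y c : F₂^ n} → x ⊕ c ≡ y ⊕ c → x ≡ y
⊕-cancelʳ {y = y} {c} e = trans (⊕-transpose e) (⊕-involutive y c)

infix 4 _∈?_
_∈?_ : ∀ {n} (x : F₂^ n) (xs : List (F₂^ n)) → Dec (x ∈ xs)
x ∈? xs = any? (≡-dec _≟ᴮ_ x) xs

∈-─ : ∀ {A : Set} {x y : A} {ys : List A} (x∈ys : x ∈ ys) →
      y ∈ ys → x ≢ y → y ∈ (ys ─ x∈ys)
∈-─ (here refl) (here refl) x≢y = contradiction refl x≢y
∈-─ (here _)    (there y∈)  _   = y∈
∈-─ (there _)   (here refl) _   = here refl
∈-─ (there x∈)  (there y∈)  x≢y = there (∈-─ x∈ y∈ x≢y)

unique-⊆⇒length≤ : ∀ {A : Set} {xs ys : List A} → Unique xs →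
                   (∀ {x} → x ∈ xs → x ∈ ys) → length xs ≤ length ys
unique-⊆⇒length≤ {xs = []}     _              _   = z≤n
unique-⊆⇒length≤ {xs = x ∷ xs} {ys} (x∉xs ∷ u) sub = begin
  suc (length xs)            ≤⟨ s≤s (unique-⊆⇒length≤ u rest) ⟩
  suc (length (ys ─ x∈ys))   ≡⟨ sym (length-removeAt′ ys (index x∈ys)) ⟩
  length ys                  ∎
  where
  open ≤-Reasoning
  x∈ys : x ∈ ys
  x∈ys = sub (here refl)
  rest : ∀ {y} → y ∈ xs → y ∈ (ys ─ x∈ys)
  rest y∈xs = ∈-─ x∈ys (sub (there y∈xs)) (All.lookup x∉xs y∈xs)

vectors : ∀ n → List (F₂^ n)
vectors zero    = [] ∷ []
vectors (suc n) = map (false ∷_) (vectors n) ++ map (true ∷_) (vectors n)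

length-vectors : ∀ n → length (vectors n) ≡ 2 ^ n
length-vectors zero    = refl
length-vectors (suc n) = begin
  length (map (false ∷_) vs ++ map (true ∷_) vs)   ≡⟨ length-++ (map (false ∷_) vs) ⟩
  length (map (false ∷_) vs) + length (map (true ∷_) vs)
    ≡⟨ cong₂ _+_ (length-map (false ∷_) vs) (length-map (true ∷_) vs) ⟩
  length vs + length vs                             ≡⟨ cong₂ _+_ (length-vectors n) size ⟩
  2 ^ n + (2 ^ n + 0)                               ∎
  where
  open ≡-Reasoning
  vs : List (F₂^ n)
  vs = vectors n
  size : length vs ≡ 2 ^ n + 0
  size = trans (length-vectors n) (sym (+-identityʳ (2 ^ n)))

∈-vectors : ∀ {n} (v : F₂^ n) → v ∈ vectors n
∈-vectors []                 = here refl
∈-vectors (false ∷ v)        = ∈-++⁺ˡ (∈-map⁺ (false ∷_) (∈-vectors v))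
∈-vectors {suc n} (true ∷ v) =
  ∈-++⁺ʳ (map (false ∷_) (vectors n)) (∈-map⁺ (true ∷_) (∈-vectors v))

unique⇒length≤2^ : ∀ {n} {xs : List (F₂^ n)} → Unique xs → length xs ≤ 2 ^ n
unique⇒length≤2^ {n} {xs} u = begin
  length xs            ≤⟨ unique-⊆⇒length≤ u (λ {x} _ → ∈-vectors x) ⟩
  length (vectors n)   ≡⟨ length-vectors n ⟩
  2 ^ n                ∎
  where open ≤-Reasoning

map-unique : ∀ {A B : Set} (f : A → B) {xs : List A} →
             (∀ {x y} → x ∈ xs → y ∈ xs → f x ≡ f y → x ≡ y) →
             Unique xs → Unique (map f xs)
map-unique f {[]}     _   []         = []
map-unique f {x ∷ xs} inj (x∉xs ∷ u) =
  All.tabulate fresh ∷ map-unique f (λ p q → inj (there p) (there q)) u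
  where
  fresh : ∀ {z} → z ∈ map f xs → f x ≢ z
  fresh z∈ e with ∈-map⁻ f z∈
  ... | y , y∈xs , refl = All.lookup x∉xs y∈xs (inj (here refl) (there y∈xs) e)

Separated : ∀ {n} → List (F₂^ n) → List (F₂^ n) → Set
Separated B C = ∀ {b c} → b ∈ B → c ∈ C → b ⊕ c ∉ B ++ C

module Doubling {n} (B C : List (F₂^ n)) {b₀ c₀ : F₂^ n}
                (b₀∈B : b₀ ∈ B) (c₀∈C : c₀ ∈ C) (sep : Separated B C) where

  S : List (F₂^ n)
  S = B ++ C

  f : F₂^ n → F₂^ n
  f x with x ⊕ c₀ ∈? C
  ... | yes _ = x ⊕ b₀
  ... | no  _ = x ⊕ c₀

  data Shift (x : F₂^ n) : F₂^ n → Set where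
    by-b₀ : x ⊕ c₀ ∈ C → Shift x (x ⊕ b₀)
    by-c₀ : x ⊕ c₀ ∉ C → Shift x (x ⊕ c₀)

  shift : ∀ x → Shift x (f x)
  shift x with x ⊕ c₀ ∈? C
  ... | yes p = by-b₀ p
  ... | no ¬p = by-c₀ ¬p

  no-crossing : ∀ {x y} → x ⊕ c₀ ∈ C → x ⊕ b₀ ≡ y ⊕ c₀ → y ∉ S
  no-crossing {x} {y} p e y∈S = sep b₀∈B p (subst (_∈ S) y≡ y∈S)
    where
    open ≡-Reasoning
    y≡ : y ≡ b₀ ⊕ (x ⊕ c₀)
    y≡ = begin
      y                ≡⟨ ⊕-transpose (sym e) ⟩
      (x ⊕ b₀) ⊕ c₀    ≡⟨ cong (_⊕ c₀) (⊕-comm x b₀) ⟩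
      (b₀ ⊕ x) ⊕ c₀    ≡⟨ ⊕-assoc b₀ x c₀ ⟩
      b₀ ⊕ (x ⊕ c₀)    ∎

  f-escapes : ∀ {x} → x ∈ S → f x ∉ S
  f-escapes {x} x∈S with f x | shift x | ∈-++⁻ B x∈S
  ... | _ | by-b₀ p  | inj₁ x∈B = contradiction (∈-++⁺ʳ B p) (sep x∈B c₀∈C)
  ... | _ | by-b₀ _  | inj₂ x∈C = subst (_∉ S) (⊕-comm b₀ x) (sep b₀∈B x∈C)
  ... | _ | by-c₀ _  | inj₁ x∈B = sep x∈B c₀∈C
  ... | _ | by-c₀ ¬p | inj₂ x∈C = [ ¬in-B , ¬p ] ∘ ∈-++⁻ B
    where
    -- (x ⊕ c₀) ⊕ x = c₀ ∈ S, so x ⊕ c₀ ∈ B would give a forbidden sum.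
    ¬in-B : x ⊕ c₀ ∉ B
    ¬in-B x⊕c₀∈B = sep x⊕c₀∈B x∈C (subst (_∈ S) (sym c₀≡) (∈-++⁺ʳ B c₀∈C))
      where
      c₀≡ : (x ⊕ c₀) ⊕ x ≡ c₀
      c₀≡ = trans (cong (_⊕ x) (⊕-comm x c₀)) (⊕-involutive c₀ x)

  -- f is injective on S: equal translates by the same vector cancel, and
  -- translates by different vectors are excluded by no-crossing.
  f-injective : ∀ {x y} → x ∈ S → y ∈ S → f x ≡ f y → x ≡ y
  f-injective {x} {y} x∈S y∈S with f x | shift x | f y | shift y
  ... | _ | by-b₀ _ | _ | by-b₀ _ = ⊕-cancelʳ
  ... | _ | by-c₀ _ | _ | by-c₀ _ = ⊕-cancelʳ
  ... | _ | by-b₀ p | _ | by-c₀ _ = λ e → contradiction y∈S (no-crossing p e)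
  ... | _ | by-c₀ _ | _ | by-b₀ q = λ e → contradiction x∈S (no-crossing q (sym e))

  doubled-unique : Unique S → Unique (S ++ map f S)
  doubled-unique uS = ++⁺ uS (map-unique f f-injective uS) disjoint
    where
    disjoint : Disjoint S (map f S)
    disjoint (v∈S , v∈fS) with ∈-map⁻ f v∈fS
    ... | x , x∈S , refl = f-escapes x∈S v∈S

  doubled-length : length (S ++ map f S) ≡ 2 * length S
  doubled-length = begin
    length (S ++ map f S)          ≡⟨ length-++ S ⟩
    length S + length (map f S)    ≡⟨ cong (length S +_) (length-map f S) ⟩
    length S + length S            ≡⟨ cong (length S +_) (sym (+-identityʳ (length S))) ⟩
    2 * length S                   ∎
    where open ≡-Reasoning

separated⇒small : ∀ {k} {B C : List (F₂^ (suc k))} {b₀ c₀ : F₂^ (suc k)} →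
                  Unique B → Unique C → Disjoint B C → b₀ ∈ B → c₀ ∈ C →
                  Separated B C → length B + length C ≤ 2 ^ k
separated⇒small {k} {B} {C} uB uC disj b₀∈B c₀∈C sep =
  *-cancelˡ-≤ 2 (begin
    2 * (length B + length C)   ≡⟨ cong (2 *_) (sym (length-++ B)) ⟩
    2 * length S                ≡⟨ sym doubled-length ⟩
    length (S ++ map f S)       ≤⟨ unique⇒length≤2^ (doubled-unique (++⁺ uB uC disj)) ⟩
    2 ^ suc k                   ∎)
  where
  open Doubling B C b₀∈B c₀∈C sep
  open ≤-Reasoning

Collision : ∀ {n} → List (F₂^ n) → List (F₂^ n) → Set
Collision B C = ∃[ b ] ∃[ c ] (b ∈ B × c ∈ C × b ⊕ c ∈ B ++ C)

collision-or-separated : ∀ {n} (B C : List (F₂^ n)) → Collision B C ⊎ Separated B C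
collision-or-separated B C with any? (λ b → any? (λ c → b ⊕ c ∈? B ++ C) C) B
... | yes hit = let (b , b∈B , hit′) = find hit ; (c , c∈C , b⊕c∈) = find hit′
                in inj₁ (b , c , b∈B , c∈C , b⊕c∈)
... | no miss = inj₂ λ b∈B c∈C b⊕c∈ → miss (lose b∈B (lose c∈C b⊕c∈))

corollary4p3 : (k : ℕ) → (B C : List (F₂^ (suc k))) →
    Unique B → Unique C →
    (∀ x → x ∈ B → x ∉ C) →
    B ≢ [] → C ≢ [] →
    length B + length C > 2 ^ k →
    ∃[ x ] ((x ∈ B ⊎ x ∈ C) × (∃[ b ] ∃[ c ] (b ∈ B × c ∈ C × x ≡ b ⊕ c)))
corollary4p3 k []      _       _  _  _    B≢[] _    _ = contradiction refl B≢[]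
corollary4p3 k (_ ∷ _) []      _  _  _    _    C≢[] _ = contradiction refl C≢[]
corollary4p3 k B@(_ ∷ _) C@(_ ∷ _) uB uC disj _ _ large with collision-or-separated B C
... | inj₁ (b , c , b∈B , c∈C , b⊕c∈) = b ⊕ c , ∈-++⁻ B b⊕c∈ , b , c , b∈B , c∈C , refl
... | inj₂ sep = contradiction
  (separated⇒small uB uC (λ (x∈B , x∈C) → disj _ x∈B x∈C) (here refl) (here refl) sep)
  (<⇒≱ large)
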